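{- Let $F_n$ be the friendship graph consisting of $n$ triangles sharing a common vertex. Then $N_{sp}(F_n)=2^n$.
   Context: All graphs are finite, simple, undirected. For $S\subseteq V(G)$, $\overline{S}=V(G)\setminus S$ and $N(v)$ denotes the open neighbourhood of $v$. A set $S$ is a super dominating set of $G$ if every vertex of $\overline{S}$ has a neighbour in $S$ and for every $u\in\overline{S}$ there is $v\in S$ with $N(v)\cap\overline{S}=\{u\}$. The super domination number $\gamma_{sp}(G)$ is the minimum cardinality of a super dominating set of $G$. $N_{sp}(G)$ denotes the number of super dominating sets of $G$ of cardinality $\gamma_{sp}(G)$. The friendship graph $F_n$ ($n\in\mathbb{N}$) is the collection of $n$ triangles all sharing one common (central) vertex and otherwise disjoint; it has $2n+1$ vertices. -}

module Defs where

open import Data.Bool using (Bool; true; false; _∧_; _∨_; not; T)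
open import Data.Nat using (ℕ; zero; suc; _+_; _/_; _⊓_; _≡ᵇ_)
open import Data.Fin using (Fin; zero; suc; toℕ)
open import Data.Fin.Subset using (Subset; inside; outside; ∣_∣)
open import Data.Vec using (Vec; []; _∷_; lookup)
open import Data.List using (List; []; _∷_; map; filter; length; foldr; _++_; allFin)
open import Data.Bool.ListAction using (all; any)
open import Relation.Nullary.Decidable using (Dec; yes; no)
open import Relation.Binary.PropositionalEquality using (_≡_; refl; cong₂; cong)

record Graph : Set where
  field
    order : ℕ
    adj   : Fin order → Fin order → Bool
    sym   : ∀ u v → adj u v ≡ adj v u
    irrefl : ∀ v → adj v v ≡ false
open Graph public

allSubsets : (m : ℕ) → List (Subset m)
allSubsets zero = [] ∷ []
allSubsets (suc m) = map (inside ∷_) (allSubsets m) ++ map (outside ∷_) (allSubsets m)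

module _ (G : Graph) where
  private
    V = allFin (order G)
    inS : Subset (order G) → Fin (order G) → Bool
    inS S v = lookup S v

  dominatesᵇ : Subset (order G) → Bool
  dominatesᵇ S = all (λ u → inS S u ∨ any (λ v → inS S v ∧ adj G u v) V) V

  privateNbrᵇ : Subset (order G) → Fin (order G) → Fin (order G) → Bool
  privateNbrᵇ S v u =
    adj G v u ∧ all (λ w → inS S w ∨ not (adj G v w) ∨ (toℕ w ≡ᵇ toℕ u)) V

  isSuperDominatingᵇ : Subset (order G) → Bool
  isSuperDominatingᵇ S =
    dominatesᵇ S ∧ all (λ u → inS S u ∨ any (λ v → inS S v ∧ privateNbrᵇ S v u) V) V

  SuperDominating : Subset (order G) → Set
  SuperDominating S = T (isSuperDominatingᵇ S)

  superDominatingSets : List (Subset (order G))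
  superDominatingSets = filter (λ S → T? (isSuperDominatingᵇ S)) (allSubsets (order G))
    where
      T? : (b : Bool) → Dec (T b)
      T? true = yes _
      T? false = no (λ ())

  -- γ_sp(G): minimum cardinality of a super dominating set
  -- (V itself is always super dominating, so order G is an upper bound)
  γsp : ℕ
  γsp = foldr _⊓_ (order G) (map ∣_∣ superDominatingSets)

  Nsp : ℕ
  Nsp = length (filter (λ S → ∣ S ∣ Data.Nat.≟ γsp) superDominatingSets)

-- Friendship graph F_n: vertex 0 is the centre; vertices suc i, suc j
-- (i, j < 2n) are adjacent iff i ≠ j and ⌊i/2⌋ = ⌊j/2⌋ (triangle k = {0, 2k+1, 2k+2}).
friendshipAdj : (n : ℕ) → Fin (suc (n + n)) → Fin (suc (n + n)) → Bool
friendshipAdj n zero zero = false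
friendshipAdj n zero (suc j) = true
friendshipAdj n (suc i) zero = true
friendshipAdj n (suc i) (suc j) =
  not (toℕ i ≡ᵇ toℕ j) ∧ (toℕ i / 2 ≡ᵇ toℕ j / 2)

≡ᵇ-sym : ∀ a b → (a ≡ᵇ b) ≡ (b ≡ᵇ a)
≡ᵇ-sym zero zero = refl
≡ᵇ-sym zero (suc b) = refl
≡ᵇ-sym (suc a) zero = refl
≡ᵇ-sym (suc a) (suc b) = ≡ᵇ-sym a b

≡ᵇ-refl : ∀ a → (a ≡ᵇ a) ≡ true
≡ᵇ-refl zero = refl
≡ᵇ-refl (suc a) = ≡ᵇ-refl a

friendship : ℕ → Graph
friendship n = record
  { order = suc (n + n)
  ; adj = friendshipAdj n
  ; sym = s
  ; irrefl = ir
  }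
  where
    s : ∀ u v → friendshipAdj n u v ≡ friendshipAdj n v u
    s zero zero = refl
    s zero (suc j) = refl
    s (suc i) zero = refl
    s (suc i) (suc j) =
      cong₂ _∧_ (cong not (≡ᵇ-sym (toℕ i) (toℕ j))) (≡ᵇ-sym (toℕ i / 2) (toℕ j / 2))
    ir : ∀ v → friendshipAdj n v v ≡ false
    ir zero = refl
    ir (suc i) rewrite ≡ᵇ-refl (toℕ i) = refl

{-# OPTIONS --safe #-}
module Submission where

-- Write a vertex set as c ∷ r, with c the centre and r the 2n leaves, paired by triangle.
-- Looking for private neighbours of a leaf outside S: if the centre is not in S, every
-- leaf must be in S (the centre would lie in N(v) ∖ S for any candidate v); if it is,
-- S is super dominating exactly when it meets every pair of leaves, the private
-- neighbour of a missing leaf being the other leaf of its triangle.  Hence for n ≥ 2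
-- the minimum size is n + 1, attained exactly by the centre plus one leaf of each
-- triangle, and there are 2^n such sets.

open import Defs renaming (sym to adj-sym)
open import Data.Bool using (Bool; true; false; _∧_; _∨_; not; _xor_; T; if_then_else_)
open import Data.Bool.ListAction using (all; any)
open import Data.Bool.Properties using (T-≡; T-∧; ⇔→≡)
open import Data.Empty using (⊥; ⊥-elim)
open import Data.Fin using (Fin; zero; suc; toℕ)
open import Data.Fin.Properties using (toℕ-injective; toℕ<n; suc-injective)
open import Data.Fin.Subset using (Subset; inside; outside; ∣_∣; ⊤)
open import Data.Fin.Subset.Properties using (⊆-antisym; ⊆⊤; ∣⊤∣≡n; ∣p∣≤∣x∷p∣)
open import Data.List using (List; []; _∷_; map; filter; length; _++_; allFin)
open import Data.List.Membership.Propositional using (_∈_; lose)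
open import Data.List.Membership.Propositional.Properties
  using (∈-allFin; ∈-map⁺; ∈-++⁺ˡ; ∈-++⁺ʳ; ∈-filter⁺)
open import Data.List.Properties using (foldr-preservesᵇ; foldr-preservesᵒ)
import Data.List.Relation.Unary.All as All
open import Data.List.Relation.Unary.All.Properties using (all⁺; all⁻; all-filter)
  renaming (tabulate⁺ to All-tabulate⁺; map⁺ to All-map⁺)
open import Data.List.Relation.Unary.Any using (here; satisfied)
open import Data.List.Relation.Unary.Any.Properties using (any⁺; any⁻)
  renaming (tabulate⁺ to Any-tabulate⁺; map⁺ to Any-map⁺)
open import Data.Nat using (ℕ; zero; suc; _+_; _∸_; _/_; _^_; _≡ᵇ_; _≤_; _<_; z≤n; s≤s; ⌊_/2⌋)
open import Data.Nat.DivMod using (m/n≡1+[m∸n]/n)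
open import Data.Nat.Properties
  using ( _≟_; +-suc; +-identityʳ; n≤1+n; ≤-trans; ≤-reflexive; ≤-antisym; <⇒≢; ≤⇒≯
        ; ⊓-glb; m⊓n≤m; m⊓n≤n; +-monoˡ-≤; m≤m+n; m^n>0; n≡⌊n+n/2⌋; ≡ᵇ⇒≡; ≡⇒≡ᵇ)
open import Data.Product using (∃; ∃₂; _×_; _,_; proj₂)
open import Data.Sum using (inj₁; inj₂)
open import Data.Vec using ([]; _∷_; lookup)
open import Data.Vec.Properties using (lookup⇒[]=)
open import Function using (_∘_; _⇔_; mk⇔; Equivalence)
open import Relation.Nullary using (Dec; yes; no; does)
open import Relation.Nullary.Decidable using (dec-false)
open import Relation.Unary using (Decidable)
open import Relation.Binary.PropositionalEquality
open ≡-Reasoning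
open Equivalence using (to; from)

countᵇ : ∀ {A : Set} → (A → Bool) → List A → ℕ
countᵇ p [] = 0
countᵇ p (x ∷ xs) = if p x then suc (countᵇ p xs) else countᵇ p xs

module _ {A : Set} where

  countᵇ-++ : ∀ (p : A → Bool) xs ys → countᵇ p (xs ++ ys) ≡ countᵇ p xs + countᵇ p ys
  countᵇ-++ p [] ys = refl
  countᵇ-++ p (x ∷ xs) ys with p x
  ... | true = cong suc (countᵇ-++ p xs ys)
  ... | false = countᵇ-++ p xs ys

  countᵇ-map : ∀ {B : Set} (p : B → Bool) (f : A → B) xs → countᵇ p (map f xs) ≡ countᵇ (p ∘ f) xs
  countᵇ-map p f [] = refl
  countᵇ-map p f (x ∷ xs) with p (f x)
  ... | true = cong suc (countᵇ-map p f xs)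
  ... | false = countᵇ-map p f xs

  countᵇ-cong : ∀ {p q : A → Bool} → (∀ x → p x ≡ q x) → ∀ xs → countᵇ p xs ≡ countᵇ q xs
  countᵇ-cong p≗q [] = refl
  countᵇ-cong {q = q} p≗q (x ∷ xs) rewrite p≗q x =
    cong (λ c → if q x then suc c else c) (countᵇ-cong p≗q xs)

  countᵇ-false : ∀ (xs : List A) → countᵇ (λ _ → false) xs ≡ 0
  countᵇ-false [] = refl
  countᵇ-false (x ∷ xs) = countᵇ-false xs

  countᵇ-pos⇒∃ : ∀ (p : A → Bool) xs → 0 < countᵇ p xs → ∃ λ x → p x ≡ true
  countᵇ-pos⇒∃ p (x ∷ xs) pos with p x in px
  ... | true = x , px
  ... | false = countᵇ-pos⇒∃ p xs pos

  length-filter∘filter : ∀ (f : A → Bool) (P? : ∀ x → Dec (T (f x))) {Q : A → Set} (Q? : Decidable Q) xs →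
    length (filter Q? (filter P? xs)) ≡ countᵇ (λ x → f x ∧ does (Q? x)) xs
  length-filter∘filter f P? Q? [] = refl
  length-filter∘filter f P? Q? (x ∷ xs) with f x | P? x
  ... | true | no ¬fx = ⊥-elim (¬fx _)
  ... | false | no _ = length-filter∘filter f P? Q? xs
  ... | true | yes _ with does (Q? x)
  ...   | true = cong suc (length-filter∘filter f P? Q? xs)
  ...   | false = length-filter∘filter f P? Q? xs

∈-allSubsets : ∀ {m} (S : Subset m) → S ∈ allSubsets m
∈-allSubsets [] = here refl
∈-allSubsets {suc m} (inside ∷ S) = ∈-++⁺ˡ (∈-map⁺ (inside ∷_) (∈-allSubsets S))
∈-allSubsets {suc m} (outside ∷ S) = ∈-++⁺ʳ _ (∈-map⁺ (outside ∷_) (∈-allSubsets S))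

countᵇ-allSubsets : ∀ {m} (p : Subset (suc m) → Bool) →
  countᵇ p (allSubsets (suc m)) ≡
  countᵇ (p ∘ (inside ∷_)) (allSubsets m) + countᵇ (p ∘ (outside ∷_)) (allSubsets m)
countᵇ-allSubsets {m} p = begin
  countᵇ p (map (inside ∷_) (allSubsets m) ++ map (outside ∷_) (allSubsets m))
    ≡⟨ countᵇ-++ p (map (inside ∷_) (allSubsets m)) _ ⟩
  countᵇ p (map (inside ∷_) (allSubsets m)) + countᵇ p (map (outside ∷_) (allSubsets m))
    ≡⟨ cong₂ _+_ (countᵇ-map p (inside ∷_) (allSubsets m)) (countᵇ-map p (outside ∷_) (allSubsets m)) ⟩
  countᵇ (p ∘ (inside ∷_)) (allSubsets m) + countᵇ (p ∘ (outside ∷_)) (allSubsets m)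
    ∎

T-all-allFin : ∀ {m} (p : Fin m → Bool) → T (all p (allFin m)) ⇔ (∀ i → T (p i))
T-all-allFin p = mk⇔
  (λ h i → All.lookup (all⁺ p _ h) (∈-allFin i))
  (λ h → all⁻ p (All-tabulate⁺ h))

T-any-allFin : ∀ {m} (p : Fin m → Bool) → T (any p (allFin m)) ⇔ ∃ (T ∘ p)
T-any-allFin p = mk⇔
  (λ h → satisfied (any⁻ p (allFin _) h))
  (λ (i , pi) → any⁺ p (Any-tabulate⁺ i pi))

T-∨-false : ∀ {b c} → T (b ∨ c) → b ≡ false → T c
T-∨-false h refl = h

T-∨-not-∨ : ∀ a b c → T (a ∨ not b ∨ c) ⇔ (T b → a ≡ false → T c)
T-∨-not-∨ true b c = mk⇔ (λ _ _ ()) (λ _ → _)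
T-∨-not-∨ false true c = mk⇔ (λ h _ _ → h) (λ h → h _ refl)
T-∨-not-∨ false false c = mk⇔ (λ _ ()) (λ _ → _)

module _ (G : Graph) where

  PrivateNeighbour : Subset (order G) → Fin (order G) → Fin (order G) → Set
  PrivateNeighbour S v u = T (adj G v u) × (∀ w → T (adj G v w) → lookup S w ≡ outside → w ≡ u)

  HasPrivateNeighbours : Subset (order G) → Set
  HasPrivateNeighbours S =
    ∀ u → lookup S u ≡ outside → ∃ λ v → lookup S v ≡ inside × PrivateNeighbour S v u

  T-privateNbrᵇ : ∀ S v u → T (privateNbrᵇ G S v u) ⇔ PrivateNeighbour S v u
  T-privateNbrᵇ S v u = mk⇔
    (λ h → let a , ws = to T-∧ h in
      a , λ w vw Sw → toℕ-injective (≡ᵇ⇒≡ _ _ (to (clause w) (to (T-all-allFin _) ws w) vw Sw)))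
    (λ (a , only-u) → from T-∧ (a , from (T-all-allFin _) λ w →
      from (clause w) λ vw Sw → ≡⇒≡ᵇ _ _ (cong toℕ (only-u w vw Sw))))
    where
      clause : ∀ w → T (lookup S w ∨ not (adj G v w) ∨ (toℕ w ≡ᵇ toℕ u)) ⇔
                     (T (adj G v w) → lookup S w ≡ outside → T (toℕ w ≡ᵇ toℕ u))
      clause w = T-∨-not-∨ (lookup S w) (adj G v w) (toℕ w ≡ᵇ toℕ u)

  -- The domination clause of the definition is implied by the private-neighbour clause.
  superDominating⇔ : ∀ S → T (isSuperDominatingᵇ G S) ⇔ HasPrivateNeighbours S
  superDominating⇔ S = mk⇔ toPrivate fromPrivate
    where
      toPrivate : T (isSuperDominatingᵇ G S) → HasPrivateNeighbours S
      toPrivate sd u Su =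
        let v , h = to (T-any-allFin _) (T-∨-false (to (T-all-allFin _) (proj₂ (to T-∧ sd)) u) Su)
            Sv , pn = to T-∧ h
        in v , to T-≡ Sv , to (T-privateNbrᵇ S v u) pn

      fromPrivate : HasPrivateNeighbours S → T (isSuperDominatingᵇ G S)
      fromPrivate hpn = from T-∧ (from (T-all-allFin _) dominated , from (T-all-allFin _) privatelyDominated)
        where
          dominated : ∀ u → T (lookup S u ∨ any (λ v → lookup S v ∧ adj G u v) (allFin (order G)))
          dominated u with lookup S u in Su
          ... | inside = _
          ... | outside = let v , Sv , vu , _ = hpn u Su in
            from (T-any-allFin _) (v , from T-∧ (from T-≡ Sv , subst T (adj-sym G v u) vu))
          privatelyDominated :
            ∀ u → T (lookup S u ∨ any (λ v → lookup S v ∧ privateNbrᵇ G S v u) (allFin (order G)))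
          privatelyDominated u with lookup S u in Su
          ... | inside = _
          ... | outside = let v , Sv , pn = hpn u Su in
            from (T-any-allFin _) (v , from T-∧ (from T-≡ Sv , from (T-privateNbrᵇ S v u) pn))

  ≤γsp : ∀ {k} → (∀ S → T (isSuperDominatingᵇ G S) → k ≤ ∣ S ∣) → k ≤ order G → k ≤ γsp G
  ≤γsp {k} lower k≤order = foldr-preservesᵇ {P = k ≤_} ⊓-glb k≤order
    (All-map⁺ (All.map (λ {S} → lower S) (all-filter _ (allSubsets (order G)))))

  γsp≤ : ∀ {k} S → T (isSuperDominatingᵇ G S) → ∣ S ∣ ≤ k → γsp G ≤ k
  γsp≤ {k} S sd ∣S∣≤k = foldr-preservesᵒ {P = _≤ k}
    (λ x y → λ { (inj₁ x≤k) → ≤-trans (m⊓n≤m x y) x≤k ; (inj₂ y≤k) → ≤-trans (m⊓n≤n x y) y≤k })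
    (order G) _
    (inj₂ (Any-map⁺ (lose (∈-filter⁺ _ (∈-allSubsets S) sd) ∣S∣≤k)))

  -- does (m ≟ n) computes to m ≡ᵇ n, by the definition of ℕ's _≟_.
  Nsp≡countᵇ : Nsp G ≡ countᵇ (λ S → isSuperDominatingᵇ G S ∧ (∣ S ∣ ≡ᵇ γsp G)) (allSubsets (order G))
  Nsp≡countᵇ = length-filter∘filter (isSuperDominatingᵇ G) _ (λ S → ∣ S ∣ ≟ γsp G) (allSubsets (order G))

-- Leaf suc p of F_n shares its triangle with leaf suc (mate p).
mate : ℕ → ℕ
mate 0 = 1
mate 1 = 0
mate (suc (suc p)) = suc (suc (mate p))

mate-involutive : ∀ p → mate (mate p) ≡ p
mate-involutive 0 = refl
mate-involutive 1 = refl
mate-involutive (suc (suc p)) = cong (λ q → suc (suc q)) (mate-involutive p)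

mate-irreflexive : ∀ p → mate p ≢ p
mate-irreflexive (suc (suc p)) eq = mate-irreflexive p (cong (λ q → q ∸ 2) eq)

mate-sym : ∀ {p q} → q ≡ mate p → p ≡ mate q
mate-sym {p} refl = sym (mate-involutive p)

mate-< : ∀ k {p} → p < k + k → mate p < k + k
mate-< (suc k) {p} p<
  rewrite +-suc k k with p | p<
... | 0 | _ = s≤s (s≤s z≤n)
... | 1 | _ = s≤s z≤n
... | suc (suc p) | s≤s (s≤s p<) = s≤s (s≤s (mate-< k p<))

[2+n]/2≡1+n/2 : ∀ n → suc (suc n) / 2 ≡ suc (n / 2)
[2+n]/2≡1+n/2 n = m/n≡1+[m∸n]/n {suc (suc n)} {2} (s≤s (s≤s z≤n))

distinct-same-half≡mate : ∀ p q → (not (p ≡ᵇ q) ∧ (p / 2 ≡ᵇ q / 2)) ≡ (q ≡ᵇ mate p)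
distinct-same-half≡mate 0 0 = refl
distinct-same-half≡mate 0 1 = refl
distinct-same-half≡mate 0 (suc (suc q)) rewrite [2+n]/2≡1+n/2 q = refl
distinct-same-half≡mate 1 0 = refl
distinct-same-half≡mate 1 1 = refl
distinct-same-half≡mate 1 (suc (suc q)) rewrite [2+n]/2≡1+n/2 q = refl
distinct-same-half≡mate (suc (suc p)) 0 rewrite [2+n]/2≡1+n/2 p = refl
distinct-same-half≡mate (suc (suc p)) 1 rewrite [2+n]/2≡1+n/2 p = refl
distinct-same-half≡mate (suc (suc p)) (suc (suc q))
  rewrite [2+n]/2≡1+n/2 p | [2+n]/2≡1+n/2 q = distinct-same-half≡mate p q

meetsEveryPair : ∀ {k} → Subset k → Bool
meetsEveryPair [] = true
meetsEveryPair (_ ∷ []) = true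
meetsEveryPair (x ∷ y ∷ r) = (x ∨ y) ∧ meetsEveryPair r

-- For odd k the last bit is unpaired; the convention for it makes oneOfEachPair≡ hold for all k.
oneOfEachPair : ∀ {k} → Subset k → Bool
oneOfEachPair [] = true
oneOfEachPair (x ∷ []) = not x
oneOfEachPair (x ∷ y ∷ r) = (x xor y) ∧ oneOfEachPair r

meetsEveryPair-missed : ∀ {k} (r : Subset k) → meetsEveryPair r ≡ false →
  ∃₂ λ i j → toℕ j ≡ mate (toℕ i) × lookup r i ≡ outside × lookup r j ≡ outside
meetsEveryPair-missed (x ∷ y ∷ r) h with meetsEveryPair r in rest
... | false with i , j , ij , ri , rj ← meetsEveryPair-missed r rest =
  suc (suc i) , suc (suc j) , cong (λ p → suc (suc p)) ij , ri , rj
meetsEveryPair-missed (outside ∷ outside ∷ r) _ | true = zero , suc zero , refl , refl , refl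

meetsEveryPair-mate : ∀ {k} (r : Subset k) → meetsEveryPair r ≡ true →
  ∀ i → lookup r i ≡ outside → mate (toℕ i) < k →
  ∃ λ j → toℕ j ≡ mate (toℕ i) × lookup r j ≡ inside
meetsEveryPair-mate (outside ∷ inside ∷ r) _ zero _ _ = suc zero , refl , refl
meetsEveryPair-mate (inside ∷ outside ∷ r) _ (suc zero) _ _ = zero , refl , refl
meetsEveryPair-mate (inside ∷ _ ∷ r) h (suc (suc i)) ri (s≤s (s≤s m<k))
  with j , ij , rj ← meetsEveryPair-mate r h i ri m<k =
  suc (suc j) , cong (λ p → suc (suc p)) ij , rj
meetsEveryPair-mate (outside ∷ inside ∷ r) h (suc (suc i)) ri (s≤s (s≤s m<k))
  with j , ij , rj ← meetsEveryPair-mate r h i ri m<k =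
  suc (suc j) , cong (λ p → suc (suc p)) ij , rj
meetsEveryPair-mate (_ ∷ []) _ zero _ (s≤s ())

meetsEveryPair⇒⌊k/2⌋≤∣r∣ : ∀ {k} (r : Subset k) → meetsEveryPair r ≡ true → ⌊ k /2⌋ ≤ ∣ r ∣
meetsEveryPair⇒⌊k/2⌋≤∣r∣ [] _ = z≤n
meetsEveryPair⇒⌊k/2⌋≤∣r∣ (_ ∷ []) _ = z≤n
meetsEveryPair⇒⌊k/2⌋≤∣r∣ (inside ∷ y ∷ r) h =
  s≤s (≤-trans (meetsEveryPair⇒⌊k/2⌋≤∣r∣ r h) (∣p∣≤∣x∷p∣ y r))
meetsEveryPair⇒⌊k/2⌋≤∣r∣ (outside ∷ inside ∷ r) h = s≤s (meetsEveryPair⇒⌊k/2⌋≤∣r∣ r h)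

oneOfEachPair≡ : ∀ {k} (r : Subset k) → oneOfEachPair r ≡ meetsEveryPair r ∧ (∣ r ∣ ≡ᵇ ⌊ k /2⌋)
oneOfEachPair≡ [] = refl
oneOfEachPair≡ (inside ∷ []) = refl
oneOfEachPair≡ (outside ∷ []) = refl
oneOfEachPair≡ (inside ∷ outside ∷ r) = oneOfEachPair≡ r
oneOfEachPair≡ (outside ∷ inside ∷ r) = oneOfEachPair≡ r
oneOfEachPair≡ (outside ∷ outside ∷ r) = refl
oneOfEachPair≡ {suc (suc k)} (inside ∷ inside ∷ r) with meetsEveryPair r in meets
... | false = refl
... | true = sym (dec-false (suc ∣ r ∣ ≟ ⌊ k /2⌋) λ eq →
  ≤⇒≯ (meetsEveryPair⇒⌊k/2⌋≤∣r∣ r meets) (≤-reflexive eq))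

countᵇ-oneOfEachPair : ∀ n → countᵇ oneOfEachPair (allSubsets (n + n)) ≡ 2 ^ n
countᵇ-oneOfEachPair zero = refl
countᵇ-oneOfEachPair (suc n) rewrite +-suc n n = begin
  countᵇ oneOfEachPair (allSubsets (suc (suc (n + n))))
    ≡⟨ countᵇ-allSubsets {suc (n + n)} oneOfEachPair ⟩
  countᵇ (oneOfEachPair ∘ (inside ∷_)) (allSubsets (suc (n + n))) +
  countᵇ (oneOfEachPair ∘ (outside ∷_)) (allSubsets (suc (n + n)))
    ≡⟨ cong₂ _+_ (countᵇ-allSubsets {n + n} (oneOfEachPair ∘ (inside ∷_)))
                 (countᵇ-allSubsets {n + n} (oneOfEachPair ∘ (outside ∷_))) ⟩
  (countᵇ (λ _ → false) A + countᵇ oneOfEachPair A) + (countᵇ oneOfEachPair A + countᵇ (λ _ → false) A)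
    ≡⟨ cong₂ (λ a b → (a + countᵇ oneOfEachPair A) + (countᵇ oneOfEachPair A + b))
             (countᵇ-false A) (countᵇ-false A) ⟩
  countᵇ oneOfEachPair A + (countᵇ oneOfEachPair A + 0)
    ≡⟨ cong (λ c → c + (c + 0)) (countᵇ-oneOfEachPair n) ⟩
  2 ^ suc n
    ∎
  where
    A : List (Subset (n + n))
    A = allSubsets (n + n)

fullSubset⇒∣p∣≡k : ∀ {k} (p : Subset k) → (∀ i → lookup p i ≡ inside) → ∣ p ∣ ≡ k
fullSubset⇒∣p∣≡k {k} p full = begin
  ∣ p ∣     ≡⟨ cong ∣_∣ (⊆-antisym ⊆⊤ (λ {i} _ → lookup⇒[]= i p (full i))) ⟩
  ∣ ⊤ {k} ∣ ≡⟨ ∣⊤∣≡n k ⟩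
  k         ∎

centreAndOneOfEachPair : ∀ {k} → Subset (suc k) → Bool
centreAndOneOfEachPair (c ∷ r) = c ∧ oneOfEachPair r

countᵇ-centreAndOneOfEachPair : ∀ n → countᵇ centreAndOneOfEachPair (allSubsets (suc (n + n))) ≡ 2 ^ n
countᵇ-centreAndOneOfEachPair n = begin
  countᵇ centreAndOneOfEachPair (allSubsets (suc (n + n)))
    ≡⟨ countᵇ-allSubsets {n + n} centreAndOneOfEachPair ⟩
  countᵇ oneOfEachPair (allSubsets (n + n)) + countᵇ (λ _ → false) (allSubsets (n + n))
    ≡⟨ cong₂ _+_ (countᵇ-oneOfEachPair n) (countᵇ-false (allSubsets (n + n))) ⟩
  2 ^ n + 0
    ≡⟨ +-identityʳ (2 ^ n) ⟩
  2 ^ n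
    ∎

module Friendship (n : ℕ) where

  private
    F : Graph
    F = friendship n

  adjacent⇒mates : ∀ i j → T (adj F (suc i) (suc j)) → toℕ j ≡ mate (toℕ i)
  adjacent⇒mates i j a = ≡ᵇ⇒≡ _ _ (subst T (distinct-same-half≡mate (toℕ i) (toℕ j)) a)

  mates⇒adjacent : ∀ i j → toℕ j ≡ mate (toℕ i) → T (adj F (suc i) (suc j))
  mates⇒adjacent i j ij = subst T (sym (distinct-same-half≡mate (toℕ i) (toℕ j))) (≡⇒≡ᵇ _ _ ij)

  superDominating-centreIn⇒meetsEveryPair :
    ∀ r → T (isSuperDominatingᵇ F (inside ∷ r)) → meetsEveryPair r ≡ true
  superDominating-centreIn⇒meetsEveryPair r sd with meetsEveryPair r in meets
  ... | true = refl
  ... | false with i , j , ij , ri , rj ← meetsEveryPair-missed r meets =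
    ⊥-elim (noPrivateNeighbour (to (superDominating⇔ F (inside ∷ r)) sd (suc i) ri))
    where
      noPrivateNeighbour :
        (∃ λ v → lookup (inside ∷ r) v ≡ inside × PrivateNeighbour F (inside ∷ r) v (suc i)) → ⊥
      noPrivateNeighbour (zero , _ , _ , only-i) =
        mate-irreflexive (toℕ i) (trans (sym ij) (cong toℕ (suc-injective (only-i (suc j) _ rj))))
      noPrivateNeighbour (suc k , rk , ki , _)
        with refl ← toℕ-injective (trans (mate-sym (adjacent⇒mates k i ki)) (sym ij))
        with () ← trans (sym rk) rj

  superDominating-centreOut⇒full :
    ∀ r → T (isSuperDominatingᵇ F (outside ∷ r)) → ∀ i → lookup r i ≡ inside
  superDominating-centreOut⇒full r sd i with lookup r i in ri
  ... | inside = refl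
  ... | outside = ⊥-elim (noPrivateNeighbour (to (superDominating⇔ F (outside ∷ r)) sd (suc i) ri))
    where
      noPrivateNeighbour :
        (∃ λ v → lookup (outside ∷ r) v ≡ inside × PrivateNeighbour F (outside ∷ r) v (suc i)) → ⊥
      noPrivateNeighbour (suc k , _ , _ , only-i) with () ← only-i zero _ refl

  meetsEveryPair⇒superDominating-centreIn :
    ∀ r → meetsEveryPair r ≡ true → T (isSuperDominatingᵇ F (inside ∷ r))
  meetsEveryPair⇒superDominating-centreIn r meets = from (superDominating⇔ F (inside ∷ r)) privateMate
    where
      privateMate : HasPrivateNeighbours F (inside ∷ r)
      privateMate (suc i) ri with j , ij , rj ← meetsEveryPair-mate r meets i ri (mate-< n (toℕ<n i)) =
        suc j , rj , mates⇒adjacent j i (mate-sym ij) , only-i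
        where
          only-i : ∀ w → T (adj F (suc j) w) → lookup (inside ∷ r) w ≡ outside → w ≡ suc i
          only-i (suc k) jk _ =
            cong suc (toℕ-injective (trans (adjacent⇒mates j k jk) (sym (mate-sym ij))))

  superDominating-centreIn≡meetsEveryPair : ∀ r → isSuperDominatingᵇ F (inside ∷ r) ≡ meetsEveryPair r
  superDominating-centreIn≡meetsEveryPair r = ⇔→≡ (mk⇔
    (superDominating-centreIn⇒meetsEveryPair r ∘ from T-≡)
    (to T-≡ ∘ meetsEveryPair⇒superDominating-centreIn r))

  superDominating⇒size : 1 ≤ n → ∀ S → T (isSuperDominatingᵇ F S) → suc n ≤ ∣ S ∣
  superDominating⇒size _ (inside ∷ r) sd = s≤s (subst (_≤ ∣ r ∣) (sym (n≡⌊n+n/2⌋ n))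
    (meetsEveryPair⇒⌊k/2⌋≤∣r∣ r (superDominating-centreIn⇒meetsEveryPair r sd)))
  superDominating⇒size 1≤n (outside ∷ r) sd = subst (suc n ≤_)
    (sym (fullSubset⇒∣p∣≡k r (superDominating-centreOut⇒full r sd))) (+-monoˡ-≤ n 1≤n)

  superDominatingOfSize1+n≡centreAndOneOfEachPair :
    2 ≤ n → ∀ S → (isSuperDominatingᵇ F S ∧ (∣ S ∣ ≡ᵇ suc n)) ≡ centreAndOneOfEachPair S
  superDominatingOfSize1+n≡centreAndOneOfEachPair _ (inside ∷ r) = begin
    isSuperDominatingᵇ F (inside ∷ r) ∧ (∣ r ∣ ≡ᵇ n)
      ≡⟨ cong₂ (λ b m → b ∧ (∣ r ∣ ≡ᵇ m)) (superDominating-centreIn≡meetsEveryPair r) (n≡⌊n+n/2⌋ n) ⟩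
    meetsEveryPair r ∧ (∣ r ∣ ≡ᵇ ⌊ n + n /2⌋)
      ≡⟨ oneOfEachPair≡ r ⟨
    oneOfEachPair r
      ∎
  superDominatingOfSize1+n≡centreAndOneOfEachPair 2≤n (outside ∷ r)
    with isSuperDominatingᵇ F (outside ∷ r) in sd
  ... | false = refl
  ... | true = dec-false (∣ r ∣ ≟ suc n) λ ∣r∣≡1+n → <⇒≢ (+-monoˡ-≤ n 2≤n) (begin
    suc n     ≡⟨ ∣r∣≡1+n ⟨
    ∣ r ∣     ≡⟨ fullSubset⇒∣p∣≡k r (superDominating-centreOut⇒full r (from T-≡ sd)) ⟩
    n + n     ∎)

  superDominatingOfSize1+n : 2 ≤ n → ∃ λ S → T (isSuperDominatingᵇ F S) × ∣ S ∣ ≡ suc n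
  superDominatingOfSize1+n 2≤n
    with S , shaped ← countᵇ-pos⇒∃ centreAndOneOfEachPair (allSubsets (suc (n + n)))
                        (subst (0 <_) (sym (countᵇ-centreAndOneOfEachPair n)) (m^n>0 2 n))
    with sd , size ← to T-∧ (from T-≡ (trans (superDominatingOfSize1+n≡centreAndOneOfEachPair 2≤n S) shaped))
    = S , sd , ≡ᵇ⇒≡ _ _ size

  γsp-friendship : 2 ≤ n → γsp F ≡ suc n
  γsp-friendship 2≤n with S , sd , size ← superDominatingOfSize1+n 2≤n = ≤-antisym
    (γsp≤ F S sd (≤-reflexive size))
    (≤γsp F (superDominating⇒size (≤-trans (n≤1+n 1) 2≤n)) (s≤s (m≤m+n n n)))

  minimumSuperDominating≡centreAndOneOfEachPair :
    2 ≤ n → ∀ S → (isSuperDominatingᵇ F S ∧ (∣ S ∣ ≡ᵇ γsp F)) ≡ centreAndOneOfEachPair S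
  minimumSuperDominating≡centreAndOneOfEachPair 2≤n S rewrite γsp-friendship 2≤n =
    superDominatingOfSize1+n≡centreAndOneOfEachPair 2≤n S

theorem6p2 : (n : ℕ) → 2 ≤ n → Nsp (friendship n) ≡ 2 ^ n
theorem6p2 n 2≤n = begin
  Nsp (friendship n)
    ≡⟨ Nsp≡countᵇ (friendship n) ⟩
  countᵇ (λ S → isSuperDominatingᵇ (friendship n) S ∧ (∣ S ∣ ≡ᵇ γsp (friendship n))) (allSubsets (suc (n + n)))
    ≡⟨ countᵇ-cong (minimumSuperDominating≡centreAndOneOfEachPair 2≤n) (allSubsets (suc (n + n))) ⟩
  countᵇ centreAndOneOfEachPair (allSubsets (suc (n + n)))
    ≡⟨ countᵇ-centreAndOneOfEachPair n ⟩
  2 ^ n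
    ∎
  where open Friendship n
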